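{- Let $i$ be a positive integer, let $D$ be an $(i,2)$ digraph, let $H$ be a hole of length $l\geq 5$ in $U(D)$, and let $C$ be the cycle obtained from $H$ by $\Gamma_H$. Then every vertex on $C$ having two out-neighbors in $V(H)$ is not incident to any chord of $C$ in $P(D)$.
   Context: An $(i,j)$ digraph is an acyclic digraph in which every vertex has indegree at most $i$ and outdegree at most $j$. $U(D)$ is the underlying graph of $D$ (edge $uv$ iff $(u,v)$ or $(v,u)$ is an arc). The phylogeny graph $P(D)$ has vertex set $V(D)$ and an edge between distinct $u,v$ iff $(u,v)\in A(D)$ or $(v,u)\in A(D)$ or $u,v$ have a common out-neighbor. A hole is an induced cycle of length at least $4$. A chord of a cycle $C$ in $P(D)$ is an edge of $P(D)$ joining two vertices nonconsecutive on $C$. For a hole $H=v_1\cdots v_lv_1$ of $U(D)$ with $l\ge 5$, $\Gamma_H$ is the set of vertices of $H$ with exactly two in-neighbors in the subdigraph $D_H$ of $D$ induced by $V(H)$ (no two consecutive on $H$), and the cycle obtained from $H$ by $\Gamma_H$ is the cycle in $P(D)$ on $V(H)-\Gamma_H$ in the cyclic order of $H$ (each path $v_{a-1}v_av_{a+1}$ with $v_a\in\Gamma_H$ replaced by the edge $v_{a-1}v_{a+1}$). -}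

module Defs where

open import Data.Nat using (ℕ; zero; suc; _+_; _≤_; _<_)
open import Data.Fin using (Fin; toℕ)
import Data.Fin as F
open import Data.Bool using (Bool; true; false; if_then_else_; T)
open import Data.Product using (_×_; ∃)
open import Data.Sum using (_⊎_)
open import Relation.Nullary using (¬_)
open import Relation.Binary.PropositionalEquality using (_≡_)
open import Relation.Binary.Construct.Closure.Transitive using (TransClosure)
open import Function.Definitions using (Injective)

Arcs : ℕ → Set
Arcs n = Fin n → Fin n → Bool

Arc : ∀ {n} → Arcs n → Fin n → Fin n → Set
Arc arc u v = T (arc u v)

card : ∀ {m} → (Fin m → Bool) → ℕ
card {zero}  f = 0
card {suc m} f = (if f F.zero then 1 else 0) + card (λ x → f (F.suc x))

indeg : ∀ {n} → Arcs n → Fin n → ℕ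
indeg arc v = card (λ u → arc u v)

outdeg : ∀ {n} → Arcs n → Fin n → ℕ
outdeg arc v = card (λ w → arc v w)

Acyclic : ∀ {n} → Arcs n → Set
Acyclic arc = ∀ v → ¬ TransClosure (Arc arc) v v

IJDigraph : ℕ → ℕ → ∀ {n} → Arcs n → Set
IJDigraph i j arc = Acyclic arc × (∀ v → indeg arc v ≤ i) × (∀ v → outdeg arc v ≤ j)

UAdj : ∀ {n} → Arcs n → Fin n → Fin n → Set
UAdj arc u v = Arc arc u v ⊎ Arc arc v u

PAdj : ∀ {n} → Arcs n → Fin n → Fin n → Set
PAdj arc u v = ¬ (u ≡ v) × (Arc arc u v ⊎ Arc arc v u ⊎ ∃ (λ w → Arc arc u w × Arc arc v w))

CycAdj : ∀ {l} → Fin l → Fin l → Set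
CycAdj {l} a b =
  toℕ b ≡ suc (toℕ a) ⊎ toℕ a ≡ suc (toℕ b)
  ⊎ (toℕ a ≡ 0 × suc (toℕ b) ≡ l) ⊎ (toℕ b ≡ 0 × suc (toℕ a) ≡ l)

-- h : Fin l → Fin n lists the vertices of a hole of length l in U(D),
-- in cyclic order: h injective, and U(D)-adjacency among them is exactly
-- cyclic consecutiveness (induced cycle), with l ≥ 4.
IsHole : ∀ {n} → Arcs n → (l : ℕ) → (Fin l → Fin n) → Set
IsHole arc l h = 4 ≤ l × Injective _≡_ _≡_ h × (∀ a b → (UAdj arc (h a) (h b) → CycAdj a b) × (CycAdj a b → UAdj arc (h a) (h b)))

indegH : ∀ {n l} → Arcs n → (Fin l → Fin n) → Fin l → ℕ
indegH arc h a = card (λ b → arc (h b) (h a))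

outdegH : ∀ {n l} → Arcs n → (Fin l → Fin n) → Fin l → ℕ
outdegH arc h a = card (λ b → arc (h a) (h b))

InΓ : ∀ {n l} → Arcs n → (Fin l → Fin n) → Fin l → Set
InΓ arc h a = indegH arc h a ≡ 2

-- c lies strictly inside the forward cyclic interval from a to b (a ≠ b)
Between : ∀ {l} → Fin l → Fin l → Fin l → Set
Between a b c =
  (toℕ a < toℕ c × toℕ c < toℕ b)
  ⊎ (toℕ b < toℕ a × (toℕ a < toℕ c ⊎ toℕ c < toℕ b))

-- The cycle C obtained from H by Γ_H has vertex set {h a | a ∉ Γ_H} in the
-- cyclic order of H.  Two distinct vertices of C are consecutive on C iff
-- one of the two arcs of H between them has all its interior vertices in Γ_H.
OnC : ∀ {n l} → Arcs n → (Fin l → Fin n) → Fin l → Set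
OnC arc h a = ¬ InΓ arc h a

ConsecOnC : ∀ {n l} → Arcs n → (Fin l → Fin n) → Fin l → Fin l → Set
ConsecOnC arc h a b =
  (∀ c → Between a b c → InΓ arc h c) ⊎ (∀ c → Between b a c → InΓ arc h c)

IncidentToChordOfC : ∀ {n l} → Arcs n → (Fin l → Fin n) → Fin l → Set
IncidentToChordOfC arc h a =
  ∃ (λ b → OnC arc h b × ¬ (a ≡ b) × ¬ ConsecOnC arc h a b × PAdj arc (h a) (h b))

-- A chord of C at a is either an arc of D, hence an edge of the hole H, whose ends are
-- consecutive on H and a fortiori on C; or it comes from a common out-neighbour w of a and b.
-- Since a has outdegree at most 2 and already two out-neighbours on H, w lies on H. Then a
-- and b are the two neighbours of w on H, and these are exactly the in-neighbours of w in
-- D_H, so w ∈ Γ_H is the only vertex of H between a and b: they are consecutive on C.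
module Submission where

open import Defs
open import Data.Nat using (ℕ; zero; suc; _≤_; _<_; z≤n; s≤s; s≤s⁻¹)
open import Data.Nat.Properties
  using (≤-trans; ≤-reflexive; ≤-antisym; m≤n⇒m≤1+n; <⇒≱; <⇒≤; 1+n≰n; <-irrefl; n≮0; n<1⇒n≡0; suc-injective; <-trans)
open import Data.Fin using (Fin; zero; suc; toℕ; _≟_)
open import Data.Fin.Properties using (toℕ-injective; toℕ<n)
open import Data.Fin.Subset using (Subset; _∈_; _∉_; _-_; ∣_∣; Nonempty; Empty; inside; outside)
open import Data.Fin.Subset.Properties
  using (p─⊥≡p; Empty-unique; ∣⊥∣≡0; nonempty?; x∈p⇒∣p-x∣<∣p∣; x∈p∧x≢y⇒x∈p-y; p─q⊆p)
open import Data.Bool using (Bool; true; false; T)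
open import Data.Bool.Properties using (T-≡)
open import Data.Vec as Vec using (_∷_; tabulate)
open import Data.Vec.Properties using (lookup∘tabulate; lookup⇒[]=; []=⇒lookup)
open import Data.List using ([]; _∷_; length)
open import Data.List.Membership.Propositional using () renaming (_∈_ to _∈ˡ_)
open import Data.List.Relation.Unary.Any using (here; there)
open import Data.List.Relation.Unary.All as All using (All; []; _∷_)
open import Data.List.Relation.Unary.AllPairs using ([]; _∷_)
open import Data.List.Relation.Unary.Unique.Propositional using (Unique)
open import Data.Product using (∃; ∃₂; _×_; _,_; proj₁; proj₂)
open import Data.Sum using (_⊎_; inj₁; inj₂; [_,_]′; swap)
open import Function using (_∘_; case_of_; Equivalence)
open import Function.Definitions using (Injective)
open import Relation.Nullary using (¬_; yes; no; contradiction)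
open import Relation.Binary.PropositionalEquality
  using (_≡_; _≢_; refl; sym; trans; cong; subst; ≢-sym)

open Equivalence using (to; from)

private variable
  m n l : ℕ

x∉p-x : ∀ {x : Fin n} {p : Subset n} → x ∉ p - x
x∉p-x {x = zero}  {_ ∷ _} ()
x∉p-x {x = suc x} {_ ∷ p} (Vec.there x∈p-x) = x∉p-x x∈p-x

∣p∣≤1+∣p-x∣ : ∀ (p : Subset n) x → ∣ p ∣ ≤ suc ∣ p - x ∣
∣p∣≤1+∣p-x∣ (inside  ∷ p) zero    = s≤s (≤-reflexive (cong ∣_∣ (sym (p─⊥≡p p))))
∣p∣≤1+∣p-x∣ (outside ∷ p) zero    = m≤n⇒m≤1+n (≤-reflexive (cong ∣_∣ (sym (p─⊥≡p p))))
∣p∣≤1+∣p-x∣ (inside  ∷ p) (suc x) = s≤s (∣p∣≤1+∣p-x∣ p x)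
∣p∣≤1+∣p-x∣ (outside ∷ p) (suc x) = ∣p∣≤1+∣p-x∣ p x

Empty⇒∣p∣≡0 : {p : Subset n} → Empty p → ∣ p ∣ ≡ 0
Empty⇒∣p∣≡0 {n} p-empty = trans (cong ∣_∣ (Empty-unique p-empty)) (∣⊥∣≡0 n)

∣p∣≤length : ∀ {p : Subset n} ys → (∀ {x} → x ∈ p → x ∈ˡ ys) → ∣ p ∣ ≤ length ys
∣p∣≤length [] p⊆[] = ≤-reflexive (Empty⇒∣p∣≡0 λ (_ , x∈p) → case p⊆[] x∈p of λ ())
∣p∣≤length {p = p} (y ∷ ys) p⊆y∷ys = ≤-trans (∣p∣≤1+∣p-x∣ p y) (s≤s (∣p∣≤length ys p-y⊆ys))
  where
  p-y⊆ys : ∀ {x} → x ∈ p - y → x ∈ˡ ys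
  p-y⊆ys x∈p-y with p⊆y∷ys (p─q⊆p p _ x∈p-y)
  ... | here refl  = contradiction x∈p-y x∉p-x
  ... | there x∈ys = x∈ys

length≤∣p∣ : ∀ {p : Subset n} {xs} → Unique xs → All (_∈ p) xs → length xs ≤ ∣ p ∣
length≤∣p∣ [] [] = z≤n
length≤∣p∣ {p = p} {x ∷ _} (x≢xs ∷ xs!) (x∈p ∷ xs⊆p) =
  ≤-trans (s≤s (length≤∣p∣ xs! (All.zipWith in-p-x (x≢xs , xs⊆p)))) (x∈p⇒∣p-x∣<∣p∣ x∈p)
  where
  in-p-x : ∀ {y} → x ≢ y × y ∈ p → y ∈ p - x
  in-p-x (x≢y , y∈p) = x∈p∧x≢y⇒x∈p-y y∈p (≢-sym x≢y)

1≤∣p∣⇒Nonempty : {p : Subset n} → 1 ≤ ∣ p ∣ → Nonempty p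
1≤∣p∣⇒Nonempty {p = p} 1≤∣p∣ with nonempty? p
... | yes p-nonempty = p-nonempty
... | no  p-empty    = case subst (1 ≤_) (Empty⇒∣p∣≡0 p-empty) 1≤∣p∣ of λ ()

2≤∣p∣⇒two-members : {p : Subset n} → 2 ≤ ∣ p ∣ → ∃₂ λ x y → x ≢ y × x ∈ p × y ∈ p
2≤∣p∣⇒two-members {p = p} 2≤∣p∣ with 1≤∣p∣⇒Nonempty (≤-trans (s≤s z≤n) 2≤∣p∣)
... | x , x∈p with 1≤∣p∣⇒Nonempty {p = p - x} (s≤s⁻¹ (≤-trans 2≤∣p∣ (∣p∣≤1+∣p-x∣ p x)))
... | y , y∈p-x = x , y , (λ { refl → x∉p-x y∈p-x }) , x∈p , p─q⊆p p _ y∈p-x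

card≡∣tabulate∣ : (f : Fin m → Bool) → card f ≡ ∣ tabulate f ∣
card≡∣tabulate∣ {zero}  f = refl
card≡∣tabulate∣ {suc m} f with f zero
... | true  = cong suc (card≡∣tabulate∣ (f ∘ suc))
... | false = card≡∣tabulate∣ (f ∘ suc)

∈-tabulate⁺ : ∀ {f : Fin m → Bool} {x} → T (f x) → x ∈ tabulate f
∈-tabulate⁺ {f = f} {x} fx = lookup⇒[]= x (tabulate f) (trans (lookup∘tabulate f x) (to T-≡ fx))

∈-tabulate⁻ : ∀ {f : Fin m → Bool} {x} → x ∈ tabulate f → T (f x)
∈-tabulate⁻ {f = f} {x} x∈f = from T-≡ (trans (sym (lookup∘tabulate f x)) ([]=⇒lookup x∈f))

card≤length : ∀ {f : Fin m → Bool} ys → (∀ {x} → T (f x) → x ∈ˡ ys) → card f ≤ length ys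
card≤length {f = f} ys f⊆ys =
  subst (_≤ length ys) (sym (card≡∣tabulate∣ f)) (∣p∣≤length ys (f⊆ys ∘ ∈-tabulate⁻))

length≤card : ∀ {f : Fin m → Bool} {xs} → Unique xs → All (T ∘ f) xs → length xs ≤ card f
length≤card {f = f} xs! xs⊆f =
  subst (_ ≤_) (sym (card≡∣tabulate∣ f)) (length≤∣p∣ xs! (All.map ∈-tabulate⁺ xs⊆f))

2≤card⇒two-witnesses : ∀ {f : Fin m → Bool} → 2 ≤ card f → ∃₂ λ x y → x ≢ y × T (f x) × T (f y)
2≤card⇒two-witnesses {f = f} 2≤card
  with 2≤∣p∣⇒two-members (subst (2 ≤_) (card≡∣tabulate∣ f) 2≤card)
... | x , y , x≢y , x∈f , y∈f = x , y , x≢y , ∈-tabulate⁻ x∈f , ∈-tabulate⁻ y∈f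

CycSucc : Fin l → Fin l → Set
CycSucc {l} x y = toℕ y ≡ suc (toℕ x) ⊎ (toℕ y ≡ 0 × suc (toℕ x) ≡ l)

CycAdj⇒CycSucc : ∀ {a b : Fin l} → CycAdj a b → CycSucc a b ⊎ CycSucc b a
CycAdj⇒CycSucc (inj₁ b≡1+a)               = inj₁ (inj₁ b≡1+a)
CycAdj⇒CycSucc (inj₂ (inj₁ a≡1+b))        = inj₂ (inj₁ a≡1+b)
CycAdj⇒CycSucc (inj₂ (inj₂ (inj₁ a-wrap))) = inj₂ (inj₂ a-wrap)
CycAdj⇒CycSucc (inj₂ (inj₂ (inj₂ b-wrap))) = inj₁ (inj₂ b-wrap)

CycSucc-functional : ∀ {x y z : Fin l} → CycSucc x y → CycSucc x z → y ≡ z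
CycSucc-functional (inj₁ y≡1+x) (inj₁ z≡1+x) = toℕ-injective (trans y≡1+x (sym z≡1+x))
CycSucc-functional {y = y} (inj₁ y≡1+x) (inj₂ (_ , 1+x≡l)) =
  contradiction (toℕ<n y) (<-irrefl (trans y≡1+x 1+x≡l))
CycSucc-functional {z = z} (inj₂ (_ , 1+x≡l)) (inj₁ z≡1+x) =
  contradiction (toℕ<n z) (<-irrefl (trans z≡1+x 1+x≡l))
CycSucc-functional (inj₂ (y≡0 , _)) (inj₂ (z≡0 , _)) = toℕ-injective (trans y≡0 (sym z≡0))

CycSucc-injective : ∀ {x y z : Fin l} → CycSucc x z → CycSucc y z → x ≡ y
CycSucc-injective (inj₁ z≡1+x) (inj₁ z≡1+y) = toℕ-injective (suc-injective (trans (sym z≡1+x) z≡1+y))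
CycSucc-injective (inj₁ z≡1+x) (inj₂ (z≡0 , _)) = case trans (sym z≡1+x) z≡0 of λ ()
CycSucc-injective (inj₂ (z≡0 , _)) (inj₁ z≡1+y) = case trans (sym z≡1+y) z≡0 of λ ()
CycSucc-injective (inj₂ (_ , 1+x≡l)) (inj₂ (_ , 1+y≡l)) =
  toℕ-injective (suc-injective (trans 1+x≡l (sym 1+y≡l)))

CycAdj-around : ∀ {a b c : Fin l} → a ≢ b → CycAdj a c → CycAdj b c
  → CycSucc a c × CycSucc c b ⊎ CycSucc b c × CycSucc c a
CycAdj-around a≢b a~c b~c with CycAdj⇒CycSucc a~c | CycAdj⇒CycSucc b~c
... | inj₁ a↦c | inj₁ b↦c = contradiction (CycSucc-injective a↦c b↦c) a≢b
... | inj₂ c↦a | inj₂ c↦b = contradiction (CycSucc-functional c↦a c↦b) a≢b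
... | inj₁ a↦c | inj₂ c↦b = inj₁ (a↦c , c↦b)
... | inj₂ c↦a | inj₁ b↦c = inj₂ (b↦c , c↦a)

CycAdj-neighbours : ∀ {a b c d : Fin l} → a ≢ b → CycAdj a c → CycAdj b c → CycAdj d c
  → d ∈ˡ a ∷ b ∷ []
CycAdj-neighbours a≢b a~c b~c d~c with CycAdj-around a≢b a~c b~c | CycAdj⇒CycSucc d~c
... | inj₁ (a↦c , _) | inj₁ d↦c = here (CycSucc-injective d↦c a↦c)
... | inj₁ (_ , c↦b) | inj₂ c↦d = there (here (CycSucc-functional c↦d c↦b))
... | inj₂ (b↦c , _) | inj₁ d↦c = there (here (CycSucc-injective d↦c b↦c))
... | inj₂ (_ , c↦a) | inj₂ c↦d = here (CycSucc-functional c↦d c↦a)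

CycSucc⇒¬Between : ∀ {a b c : Fin l} → CycSucc a b → ¬ Between a b c
CycSucc⇒¬Between {c = c} (inj₁ b≡1+a) (inj₁ (a<c , c<b)) =
  <⇒≱ a<c (s≤s⁻¹ (subst (toℕ c <_) b≡1+a c<b))
CycSucc⇒¬Between {a = a} (inj₁ b≡1+a) (inj₂ (b<a , _)) =
  1+n≰n (<⇒≤ (subst (_< toℕ a) b≡1+a b<a))
CycSucc⇒¬Between {c = c} (inj₂ (b≡0 , _)) (inj₁ (_ , c<b)) = n≮0 (subst (toℕ c <_) b≡0 c<b)
CycSucc⇒¬Between {c = c} (inj₂ (_ , 1+a≡l)) (inj₂ (_ , inj₁ a<c)) =
  <⇒≱ a<c (s≤s⁻¹ (subst (toℕ c <_) (sym 1+a≡l) (toℕ<n c)))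
CycSucc⇒¬Between {c = c} (inj₂ (b≡0 , _)) (inj₂ (_ , inj₂ c<b)) = n≮0 (subst (toℕ c <_) b≡0 c<b)

last-maximal : ∀ {a x : Fin l} → suc (toℕ a) ≡ l → ¬ toℕ a < toℕ x
last-maximal {x = x} 1+a≡l a<x = <⇒≱ a<x (s≤s⁻¹ (subst (toℕ x <_) (sym 1+a≡l) (toℕ<n x)))

squeeze : ∀ {a c x : Fin l} → toℕ c ≡ suc (toℕ a) → toℕ a < toℕ x → toℕ x < suc (toℕ c) → x ≡ c
squeeze {x = x} c≡1+a a<x x<1+c =
  toℕ-injective (≤-antisym (s≤s⁻¹ x<1+c) (subst (_≤ toℕ x) (sym c≡1+a) a<x))

CycSucc²⇒Between≡ : ∀ {a b c x : Fin l} → CycSucc a c → CycSucc c b → Between a b x → x ≡ c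
CycSucc²⇒Between≡ {x = x} a↦c c↦b x∈⟨a,b⟩ with a↦c | c↦b | x∈⟨a,b⟩
... | inj₁ c≡1+a | inj₁ b≡1+c | inj₁ (a<x , x<b) = squeeze c≡1+a a<x (subst (toℕ x <_) b≡1+c x<b)
... | inj₁ c≡1+a | inj₁ b≡1+c | inj₂ (b<a , _) =
  contradiction (<-trans (≤-reflexive (sym c≡1+a)) (<-trans (≤-reflexive (sym b≡1+c)) b<a)) (<-irrefl refl)
... | _ | inj₂ (b≡0 , _) | inj₁ (_ , x<b)       = contradiction (subst (toℕ x <_) b≡0 x<b) n≮0
... | _ | inj₂ (b≡0 , _) | inj₂ (_ , inj₂ x<b) = contradiction (subst (toℕ x <_) b≡0 x<b) n≮0
... | inj₁ c≡1+a | inj₂ (_ , 1+c≡l) | inj₂ (_ , inj₁ a<x) =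
  squeeze c≡1+a a<x (subst (toℕ x <_) (sym 1+c≡l) (toℕ<n x))
... | inj₂ (_ , 1+a≡l) | _ | inj₁ (a<x , _)       = contradiction a<x (last-maximal 1+a≡l)
... | inj₂ (_ , 1+a≡l) | _ | inj₂ (_ , inj₁ a<x) = contradiction a<x (last-maximal 1+a≡l)
... | inj₂ (c≡0 , _) | inj₁ b≡1+c | inj₂ (_ , inj₂ x<b) =
  toℕ-injective (trans (n<1⇒n≡0 (subst (toℕ x <_) (trans b≡1+c (cong suc c≡0)) x<b)) (sym c≡0))

outdeg≤2⇒out-neighbours : ∀ (arc : Arcs n) {v x y w} → outdeg arc v ≤ 2 → x ≢ y
  → Arc arc v x → Arc arc v y → Arc arc v w → w ≡ x ⊎ w ≡ y
outdeg≤2⇒out-neighbours _ {x = x} {y} {w} outdeg≤2 x≢y v→x v→y v→w with w ≟ x | w ≟ y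
... | yes w≡x | _       = inj₁ w≡x
... | no  _   | yes w≡y = inj₂ w≡y
... | no  w≢x | no  w≢y =
  case ≤-trans (length≤card distinct (v→x ∷ v→y ∷ v→w ∷ [])) outdeg≤2 of λ { (s≤s (s≤s ())) }
  where
  distinct : Unique (x ∷ y ∷ w ∷ [])
  distinct = (x≢y ∷ ≢-sym w≢x ∷ []) ∷ (≢-sym w≢y ∷ []) ∷ [] ∷ []

module OnHole {n l} (arc : Arcs n) (h : Fin l → Fin n) where

  ConsecOnC-sym : ∀ {a b} → ConsecOnC arc h a b → ConsecOnC arc h b a
  ConsecOnC-sym = swap

  CycAdj⇒ConsecOnC : ∀ {a b} → CycAdj a b → ConsecOnC arc h a b
  CycAdj⇒ConsecOnC a~b with CycAdj⇒CycSucc a~b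
  ... | inj₁ a↦b = inj₁ λ _ c∈⟨a,b⟩ → contradiction c∈⟨a,b⟩ (CycSucc⇒¬Between a↦b)
  ... | inj₂ b↦a = inj₂ λ _ c∈⟨b,a⟩ → contradiction c∈⟨b,a⟩ (CycSucc⇒¬Between b↦a)

  Γ-between⇒ConsecOnC : ∀ {a b c} → InΓ arc h c → CycSucc a c → CycSucc c b → ConsecOnC arc h a b
  Γ-between⇒ConsecOnC c∈Γ a↦c c↦b =
    inj₁ λ x x∈⟨a,b⟩ → subst (InΓ arc h) (sym (CycSucc²⇒Between≡ a↦c c↦b x∈⟨a,b⟩)) c∈Γ

  out-neighbour∈H : ∀ {a} w → Injective _≡_ _≡_ h → outdeg arc (h a) ≤ 2 → outdegH arc h a ≡ 2
    → Arc arc (h a) w → ∃ λ c → w ≡ h c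
  out-neighbour∈H w h-inj outdeg≤2 outdegH≡2 a→w
    with 2≤card⇒two-witnesses (≤-reflexive (sym outdegH≡2))
  ... | c₁ , c₂ , c₁≢c₂ , a→c₁ , a→c₂ =
    [ (c₁ ,_) , (c₂ ,_) ]′ (outdeg≤2⇒out-neighbours arc outdeg≤2 (c₁≢c₂ ∘ h-inj) a→c₁ a→c₂ a→w)

  module _ (hole : IsHole arc l h) where

    UAdj⇒CycAdj : ∀ {a b} → UAdj arc (h a) (h b) → CycAdj a b
    UAdj⇒CycAdj = proj₁ (proj₂ (proj₂ hole) _ _)

    Arc⇒CycAdj : ∀ {a b} → Arc arc (h a) (h b) → CycAdj a b
    Arc⇒CycAdj = UAdj⇒CycAdj ∘ inj₁

    common-out-neighbour∈Γ : ∀ {a b} c → a ≢ b → Arc arc (h a) (h c) → Arc arc (h b) (h c) → InΓ arc h c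
    common-out-neighbour∈Γ {a} {b} c a≢b a→c b→c = ≤-antisym
      (card≤length (a ∷ b ∷ []) (CycAdj-neighbours a≢b (Arc⇒CycAdj a→c) (Arc⇒CycAdj b→c) ∘ Arc⇒CycAdj))
      (length≤card ((a≢b ∷ []) ∷ [] ∷ []) (a→c ∷ b→c ∷ []))

    common-out-neighbour⇒ConsecOnC : ∀ {a b} c → a ≢ b → Arc arc (h a) (h c) → Arc arc (h b) (h c)
      → ConsecOnC arc h a b
    common-out-neighbour⇒ConsecOnC c a≢b a→c b→c =
      [ (λ (a↦c , c↦b) → Γ-between⇒ConsecOnC c∈Γ a↦c c↦b)
      , (λ (b↦c , c↦a) → ConsecOnC-sym (Γ-between⇒ConsecOnC c∈Γ b↦c c↦a))
      ]′ (CycAdj-around a≢b (Arc⇒CycAdj a→c) (Arc⇒CycAdj b→c))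
      where
      c∈Γ : InΓ arc h c
      c∈Γ = common-out-neighbour∈Γ c a≢b a→c b→c

corollary2p3 : (i : ℕ) → 1 ≤ i → (n : ℕ) → (arc : Arcs n) → IJDigraph i 2 arc
    → (l : ℕ) → 5 ≤ l → (h : Fin l → Fin n) → IsHole arc l h
    → (a : Fin l) → OnC arc h a → outdegH arc h a ≡ 2
    → ¬ IncidentToChordOfC arc h a
corollary2p3 _ _ n arc (_ , _ , outdeg≤2) l _ h hole a _ outdegH≡2 (b , _ , a≢b , ¬consec , _ , a—b) =
  ¬consec (chord⇒ConsecOnC a—b)
  where
  open OnHole arc h
  chord⇒ConsecOnC : Arc arc (h a) (h b) ⊎ Arc arc (h b) (h a) ⊎ ∃ (λ w → Arc arc (h a) w × Arc arc (h b) w)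
    → ConsecOnC arc h a b
  chord⇒ConsecOnC (inj₁ a→b)        = CycAdj⇒ConsecOnC (UAdj⇒CycAdj hole (inj₁ a→b))
  chord⇒ConsecOnC (inj₂ (inj₁ b→a)) = CycAdj⇒ConsecOnC (UAdj⇒CycAdj hole (inj₂ b→a))
  chord⇒ConsecOnC (inj₂ (inj₂ (w , a→w , b→w)))
    with out-neighbour∈H w (proj₁ (proj₂ hole)) (outdeg≤2 (h a)) outdegH≡2 a→w
  ... | c , refl = common-out-neighbour⇒ConsecOnC hole c a≢b a→w b→w
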